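{- Let $\mathbb{K}$ be a field with $\mathrm{char}(\mathbb{K})\neq 2$, let $X^2+a_1X+a_2$ be an irreducible polynomial over $\mathbb{K}$, let $\alpha$ be a root of it and $\mathbb{L}=\mathbb{K}(\alpha)$. Let $\beta=b_0+b_1\alpha\in\mathbb{L}$ with $b_0,b_1\in\mathbb{K}$. Then $\beta\in T_1T_1$ if and only if $$\frac{(a_1b_1+1)^2-4(b_0+a_2b_1^2)}{a_1^2-4a_2}$$ is a square in $\mathbb{K}$.
   Context: $\mathrm{Tr}=\mathrm{Tr}_{\mathbb{L}/\mathbb{K}}$ is the field trace. $T_1=\{x\in\mathbb{L}\mid\mathrm{Tr}(x)=1\}$ and $T_1T_1=\{xy\mid x,y\in T_1\}$. Here $0$ counts as a square. -}

module Defs where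

open import Level using (Level; _⊔_; suc)
open import Algebra.Bundles using (CommutativeRing)
open import Data.Product using (Σ; ∃; _×_; _,_)
open import Relation.Nullary using (¬_)

-- The inverse is a total function (with an
-- unspecified value at 0), as in Lean/Mathlib; it is only constrained on
-- nonzero elements and respects the setoid equality.
record Field (c ℓ : Level) : Set (suc (c ⊔ ℓ)) where
  field
    commutativeRing : CommutativeRing c ℓ
  open CommutativeRing commutativeRing public
  field
    _⁻¹       : Carrier → Carrier
    ⁻¹-cong   : ∀ {x y} → x ≈ y → x ⁻¹ ≈ y ⁻¹
    inverseʳ  : ∀ x → ¬ (x ≈ 0#) → x * (x ⁻¹) ≈ 1#
    0≉1       : ¬ (0# ≈ 1#)

module FieldTheory {c ℓ} (K : Field c ℓ) where
  open Field K

  2# : Carrier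
  2# = 1# + 1#

  4# : Carrier
  4# = 2# + 2#

  _/_ : Carrier → Carrier → Carrier
  x / y = x * (y ⁻¹)

  CharNot2 : Set ℓ
  CharNot2 = ¬ (2# ≈ 0#)

  -- "x is a square in K" (0 counts as a square)
  IsSquare : Carrier → Set (c ⊔ ℓ)
  IsSquare x = ∃ λ y → y * y ≈ x

  IrreducibleMonicQuadratic : Carrier → Carrier → Set (c ⊔ ℓ)
  IrreducibleMonicQuadratic a₁ a₂ =
    ¬ (Σ Carrier λ c' → Σ Carrier λ d → Σ Carrier λ e → Σ Carrier λ f →
         ¬ (c' ≈ 0#) × ¬ (e ≈ 0#) ×
         (c' * e ≈ 1#) × (c' * f + d * e ≈ a₁) × (d * f ≈ a₂))

  -- The extension L = K(α) = K[X]/(X² + a₁X + a₂), with α a root.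
  -- An element x₀ + x₁α of L is represented by the pair (x₀ , x₁)
  -- (coordinates in the K-basis {1, α}).
  module Extension (a₁ a₂ : Carrier) where

    L : Set c
    L = Carrier × Carrier

    _≈L_ : L → L → Set ℓ
    (x₀ , x₁) ≈L (y₀ , y₁) = (x₀ ≈ y₀) × (x₁ ≈ y₁)

    ι : Carrier → L
    ι x = (x , 0#)

    α : L
    α = (0# , 1#)

    -- multiplication using α² = - a₁ α - a₂
    _*L_ : L → L → L
    (x₀ , x₁) *L (y₀ , y₁) =
      ( x₀ * y₀ - a₂ * (x₁ * y₁)
      , x₀ * y₁ + x₁ * y₀ - a₁ * (x₁ * y₁) )

    -- The trace Tr_{L/K}(x) is the trace of the K-linear map (y ↦ x y) on L.
    -- In the basis {1, α}, multiplication by x = x₀ + x₁α sends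
    --   1 ↦ x₀ · 1 + x₁ · α,    α ↦ (- a₂ x₁) · 1 + (x₀ - a₁ x₁) · α,
    -- so its matrix is [[x₀ , - a₂ x₁] , [x₁ , x₀ - a₁ x₁]].
    mulMatrix : L → Carrier × Carrier × Carrier × Carrier
    mulMatrix (x₀ , x₁) = (x₀ , - (a₂ * x₁) , x₁ , x₀ - a₁ * x₁)

    trace4 : Carrier × Carrier × Carrier × Carrier → Carrier
    trace4 (m₁₁ , m₁₂ , m₂₁ , m₂₂) = m₁₁ + m₂₂

    Tr : L → Carrier
    Tr x = trace4 (mulMatrix x)

    T₁ : L → Set ℓ
    T₁ x = Tr x ≈ 1#

    T₁T₁ : L → Set (c ⊔ ℓ)
    T₁T₁ β = ∃ λ x → ∃ λ y → T₁ x × T₁ y × ((x *L y) ≈L β)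

-- An element of trace 1 is determined by its α-coordinate t: it is ½(1 + a₁t) + tα.
-- If x and y have trace 1 and α-coordinates s and t, then xy = b₀ + b₁α satisfies
-- 2b₁ = s + t and 4b₀ = 1 + a₁(s + t) + Δst, where Δ = a₁² − 4a₂.  Eliminating s + t
-- gives 4N = Δ(s − t)² for the numerator N of the criterion, so N/Δ = ((s − t)/2)².
-- Conversely, if N = Δw², the elements of trace 1 with α-coordinates b₁ ± w multiply
-- to β.  Irreducibility is used only to make Δ ≠ 0.
module Submission where

open import Defs
open import Level using (Level)
open import Algebra.Bundles using (CommutativeRing)
open import Data.Nat.Base as ℕ using (zero; suc)
import Data.Nat.Properties as ℕ
open import Data.Integer.Base as ℤ using (ℤ; +_; -[1+_]; +[1+_]; _⊖_)
import Data.Integer.Properties as ℤ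
open import Data.Maybe.Base using (Maybe; just; nothing)
open import Data.Product.Base using (∃; _×_; _,_; proj₁; proj₂; map₂)
open import Function.Bundles using (Equivalence; _⇔_; mk⇔)
open import Function.Construct.Composition using (_⇔-∘_)
open import Function.Construct.Symmetry using (⇔-sym)
open import Relation.Nullary using (¬_; yes; no)
import Relation.Binary.PropositionalEquality as ≡
import Algebra.Solver.Ring.AlmostCommutativeRing as ACR

module IntegerCoefficients {c ℓ} (R : CommutativeRing c ℓ) where
  open CommutativeRing R
  open import Algebra.Properties.Ring ring
    using (-0#≈0#; -‿involutive; -‿+-comm; -‿distribˡ-*; -‿distribʳ-*)
  open import Algebra.Properties.Semiring.Mult.TCOptimised semiring
    using (×-homo-+; ×1-homo-*) renaming (_×_ to _·_)
  open import Relation.Binary.Reasoning.Setoid setoid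

  fromℤ : ℤ → Carrier
  fromℤ (+ n)    = n · 1#
  fromℤ -[1+ n ] = - (suc n · 1#)

  suc·1 : ∀ n → suc n · 1# ≈ 1# + n · 1#
  suc·1 = ×-homo-+ 1# 1

  [1+x]-[1+y]≈x-y : ∀ x y → (1# + x) - (1# + y) ≈ x - y
  [1+x]-[1+y]≈x-y x y = begin
    (1# + x) - (1# + y)                  ≈⟨ +-cong (+-comm x 1#) (-‿+-comm 1# y) ⟨
    (x + 1#) + (- 1# + - y)              ≈⟨ +-assoc x 1# _ ⟩
    x + (1# + (- 1# + - y))              ≈⟨ +-congˡ (+-assoc 1# (- 1#) (- y)) ⟨
    x + ((1# - 1#) + - y)                ≈⟨ +-congˡ (+-congʳ (-‿inverseʳ 1#)) ⟩
    x + (0# + - y)                       ≈⟨ +-congˡ (+-identityˡ (- y)) ⟩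
    x - y                                ∎

  fromℤ-homo-neg : ∀ i → fromℤ (ℤ.- i) ≈ - fromℤ i
  fromℤ-homo-neg (+ zero)  = sym -0#≈0#
  fromℤ-homo-neg +[1+ n ]  = refl
  fromℤ-homo-neg -[1+ n ]  = sym (-‿involutive _)

  fromℤ-⊖ : ∀ m n → fromℤ (m ⊖ n) ≈ m · 1# - n · 1#
  fromℤ-⊖ m       zero    = sym (trans (+-congˡ -0#≈0#) (+-identityʳ _))
  fromℤ-⊖ zero    (suc n) = sym (+-identityˡ _)
  fromℤ-⊖ (suc m) (suc n) = begin
    fromℤ (suc m ⊖ suc n)                ≡⟨ ≡.cong fromℤ (ℤ.[1+m]⊖[1+n]≡m⊖n m n) ⟩
    fromℤ (m ⊖ n)                        ≈⟨ fromℤ-⊖ m n ⟩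
    m · 1# - n · 1#                      ≈⟨ [1+x]-[1+y]≈x-y _ _ ⟨
    (1# + m · 1#) - (1# + n · 1#)        ≈⟨ +-cong (suc·1 m) (-‿cong (suc·1 n)) ⟨
    suc m · 1# - suc n · 1#              ∎

  fromℤ-homo-+ : ∀ i j → fromℤ (i ℤ.+ j) ≈ fromℤ i + fromℤ j
  fromℤ-homo-+ (+ m)    (+ n)    = ×-homo-+ 1# m n
  fromℤ-homo-+ (+ m)    -[1+ n ] = fromℤ-⊖ m (suc n)
  fromℤ-homo-+ -[1+ m ] (+ n)    = trans (fromℤ-⊖ n (suc m)) (+-comm _ _)
  fromℤ-homo-+ -[1+ m ] -[1+ n ] = begin
    - (suc (suc (m ℕ.+ n)) · 1#)         ≡⟨ ≡.cong (λ k → - (suc k · 1#)) (ℕ.+-suc m n) ⟨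
    - ((suc m ℕ.+ suc n) · 1#)           ≈⟨ -‿cong (×-homo-+ 1# (suc m) (suc n)) ⟩
    - (suc m · 1# + suc n · 1#)          ≈⟨ -‿+-comm _ _ ⟨
    - (suc m · 1#) + - (suc n · 1#)      ∎

  fromℤ-homo-+* : ∀ m j → fromℤ (+ m ℤ.* j) ≈ m · 1# * fromℤ j
  fromℤ-homo-+* m (+ n)    = trans (reflexive (≡.cong fromℤ (≡.sym (ℤ.pos-* m n)))) (×1-homo-* m n)
  fromℤ-homo-+* m -[1+ n ] = begin
    fromℤ (+ m ℤ.* -[1+ n ])             ≡⟨ ≡.cong fromℤ (ℤ.neg-distribʳ-* (+ m) +[1+ n ]) ⟨
    fromℤ (ℤ.- (+ m ℤ.* +[1+ n ]))       ≈⟨ fromℤ-homo-neg (+ m ℤ.* +[1+ n ]) ⟩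
    - fromℤ (+ m ℤ.* +[1+ n ])           ≈⟨ -‿cong (fromℤ-homo-+* m +[1+ n ]) ⟩
    - (m · 1# * (suc n · 1#))            ≈⟨ -‿distribʳ-* _ _ ⟩
    m · 1# * - (suc n · 1#)              ∎

  fromℤ-homo-* : ∀ i j → fromℤ (i ℤ.* j) ≈ fromℤ i * fromℤ j
  fromℤ-homo-* (+ m)    j = fromℤ-homo-+* m j
  fromℤ-homo-* -[1+ m ] j = begin
    fromℤ (-[1+ m ] ℤ.* j)               ≡⟨ ≡.cong fromℤ (ℤ.neg-distribˡ-* +[1+ m ] j) ⟨
    fromℤ (ℤ.- (+[1+ m ] ℤ.* j))         ≈⟨ fromℤ-homo-neg (+[1+ m ] ℤ.* j) ⟩
    - fromℤ (+[1+ m ] ℤ.* j)             ≈⟨ -‿cong (fromℤ-homo-+* (suc m) j) ⟩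
    - (suc m · 1# * fromℤ j)             ≈⟨ -‿distribˡ-* _ _ ⟩
    - (suc m · 1#) * fromℤ j             ∎

  ℤ⟶R : ℤ.+-*-rawRing ACR.-Raw-AlmostCommutative⟶ ACR.fromCommutativeRing R
  ℤ⟶R = record
    { ⟦_⟧    = fromℤ
    ; +-homo = fromℤ-homo-+
    ; *-homo = fromℤ-homo-*
    ; -‿homo = fromℤ-homo-neg
    ; 0-homo = refl
    ; 1-homo = refl
    }

  fromℤ-≟ : ∀ i j → Maybe (fromℤ i ≈ fromℤ j)
  fromℤ-≟ i j with i ℤ.≟ j
  ... | yes ≡.refl = just refl
  ... | no _       = nothing

  open import Algebra.Solver.Ring ℤ.+-*-rawRing (ACR.fromCommutativeRing R) ℤ⟶R fromℤ-≟ public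

  -- #4 is built as #2 :+ #2 so that it denotes 4# = 2# + 2# on the nose.
  #1 #2 #4 : ∀ {n} → Polynomial n
  #1 = con (+ 1)
  #2 = con (+ 2)
  #4 = #2 :+ #2

module FieldProperties {c ℓ} (K : Field c ℓ) where
  open Field K
  open FieldTheory K
  open import Algebra.Properties.CommutativeSemigroup *-commutativeSemigroup using (x∙yz≈y∙xz)
  open import Relation.Binary.Reasoning.Setoid setoid

  *-cancelˡ : ∀ {z x y} → ¬ z ≈ 0# → z * x ≈ z * y → x ≈ y
  *-cancelˡ {z} {x} {y} z≉0 zx≈zy = begin
    x                  ≈⟨ z⁻¹[zu]≈u x ⟨
    z ⁻¹ * (z * x)     ≈⟨ *-congˡ zx≈zy ⟩
    z ⁻¹ * (z * y)     ≈⟨ z⁻¹[zu]≈u y ⟩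
    y                  ∎
    where
    z⁻¹[zu]≈u : ∀ u → z ⁻¹ * (z * u) ≈ u
    z⁻¹[zu]≈u u = begin
      z ⁻¹ * (z * u)   ≈⟨ *-assoc _ _ _ ⟨
      z ⁻¹ * z * u     ≈⟨ *-congʳ (trans (*-comm _ _) (inverseʳ z z≉0)) ⟩
      1# * u           ≈⟨ *-identityˡ u ⟩
      u                ∎

  *-≉0 : ∀ {x y} → ¬ x ≈ 0# → ¬ y ≈ 0# → ¬ x * y ≈ 0#
  *-≉0 x≉0 y≉0 xy≈0 = y≉0 (*-cancelˡ x≉0 (trans xy≈0 (sym (zeroʳ _))))

  ≈/⇔*≈ : ∀ {x n d} → ¬ d ≈ 0# → (x ≈ n / d) ⇔ (d * x ≈ n)
  ≈/⇔*≈ {x} {n} {d} d≉0 = mk⇔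
    (λ x≈n/d → trans (*-congˡ x≈n/d) d[n/d]≈n)
    (λ dx≈n → *-cancelˡ d≉0 (trans dx≈n (sym d[n/d]≈n)))
    where
    d[n/d]≈n : d * (n / d) ≈ n
    d[n/d]≈n = trans (x∙yz≈y∙xz d n (d ⁻¹)) (trans (*-congˡ (inverseʳ d d≉0)) (*-identityʳ n))

  IsSquare-/⇔ : ∀ {n d} → ¬ d ≈ 0# → IsSquare (n / d) ⇔ ∃ λ w → d * (w * w) ≈ n
  IsSquare-/⇔ d≉0 = mk⇔ (map₂ (Equivalence.to (≈/⇔*≈ d≉0))) (map₂ (Equivalence.from (≈/⇔*≈ d≉0)))

module CharacteristicNot2 {c ℓ} (K : Field c ℓ) (char≠2 : FieldTheory.CharNot2 K) where
  open Field K
  open FieldTheory K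
  open FieldProperties K
  open IntegerCoefficients commutativeRing
  open import Relation.Binary.Reasoning.Setoid setoid

  ½ : Carrier
  ½ = 2# ⁻¹

  2*½≈1 : 2# * ½ ≈ 1#
  2*½≈1 = inverseʳ 2# char≠2

  [2*½]*x≈x : ∀ x → 2# * ½ * x ≈ x
  [2*½]*x≈x x = trans (*-congʳ 2*½≈1) (*-identityˡ x)

  4≉0 : ¬ 4# ≈ 0#
  4≉0 4≈0 = *-≉0 char≠2 char≠2 (trans (solve 0 (#2 :* #2 := #4) refl) 4≈0)

  halve-square : ∀ {n k d} → 4# * n ≈ k * (d * d) → ∃ λ w → k * (w * w) ≈ n
  halve-square {n} {k} {d} 4n≈kdd = ½ * d , *-cancelˡ 4≉0 (begin
    4# * (k * (½ * d * (½ * d)))          ≈⟨ solve 3 (λ k h d → #4 :* (k :* (h :* d :* (h :* d)))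
                                                  := k :* (#2 :* h :* d :* (#2 :* h :* d))) refl k ½ d ⟩
    k * (2# * ½ * d * (2# * ½ * d))       ≈⟨ *-congˡ (*-cong ([2*½]*x≈x d) ([2*½]*x≈x d)) ⟩
    k * (d * d)                           ≈⟨ 4n≈kdd ⟨
    4# * n                                ∎)

module QuadraticExtension {c ℓ} (K : Field c ℓ) (char≠2 : FieldTheory.CharNot2 K)
                          (a₁ a₂ : Field.Carrier K) where
  open Field K
  open FieldTheory K
  open Extension a₁ a₂
  open FieldProperties K
  open CharacteristicNot2 K char≠2
  open IntegerCoefficients commutativeRing
  open import Relation.Binary.Reasoning.Setoid setoid

  Δ : Carrier
  Δ = a₁ * a₁ - 4# * a₂

  numerator : Carrier → Carrier → Carrier
  numerator b₀ b₁ = (a₁ * b₁ + 1#) * (a₁ * b₁ + 1#) - 4# * (b₀ + a₂ * (b₁ * b₁))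

  Δ-poly : ∀ {n} → Polynomial n → Polynomial n → Polynomial n
  Δ-poly a₁ a₂ = a₁ :* a₁ :- #4 :* a₂

  numerator-poly : ∀ {n} → Polynomial n → Polynomial n → Polynomial n → Polynomial n → Polynomial n
  numerator-poly a₁ a₂ b₀ b₁ = (a₁ :* b₁ :+ #1) :* (a₁ :* b₁ :+ #1) :- #4 :* (b₀ :+ a₂ :* (b₁ :* b₁))

  -- If Δ = 0 then X² + a₁X + a₂ = (X + a₁/2)².
  Δ≉0 : IrreducibleMonicQuadratic a₁ a₂ → ¬ Δ ≈ 0#
  Δ≉0 irreducible Δ≈0 = irreducible
    (1# , a₁ * ½ , 1# , a₁ * ½ , 1≉0 , 1≉0 , *-identityˡ 1# , linear , constant)
    where
    1≉0 : ¬ 1# ≈ 0#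
    1≉0 1≈0 = 0≉1 (sym 1≈0)

    a₁[2*½]≈a₁ : a₁ * (2# * ½) ≈ a₁
    a₁[2*½]≈a₁ = trans (*-comm a₁ _) ([2*½]*x≈x a₁)

    linear : 1# * (a₁ * ½) + a₁ * ½ * 1# ≈ a₁
    linear = trans (solve 2 (λ a₁ h → #1 :* (a₁ :* h) :+ a₁ :* h :* #1 := a₁ :* (#2 :* h))
                            refl a₁ ½)
                   a₁[2*½]≈a₁

    constant : a₁ * ½ * (a₁ * ½) ≈ a₂
    constant = *-cancelˡ 4≉0 (begin
      4# * (a₁ * ½ * (a₁ * ½))         ≈⟨ solve 2 (λ a₁ h → #4 :* (a₁ :* h :* (a₁ :* h))
                                                   := a₁ :* (#2 :* h) :* (a₁ :* (#2 :* h))) refl a₁ ½ ⟩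
      a₁ * (2# * ½) * (a₁ * (2# * ½))  ≈⟨ *-cong a₁[2*½]≈a₁ a₁[2*½]≈a₁ ⟩
      a₁ * a₁                          ≈⟨ solve 2 (λ a₁ a₂ → a₁ :* a₁ := Δ-poly a₁ a₂ :+ #4 :* a₂)
                                                refl a₁ a₂ ⟩
      Δ + 4# * a₂                      ≈⟨ +-congʳ Δ≈0 ⟩
      0# + 4# * a₂                     ≈⟨ +-identityˡ _ ⟩
      4# * a₂                          ∎)

  T₁⇒ : ∀ {x₀ x₁} → T₁ (x₀ , x₁) → 2# * x₀ ≈ 1# + a₁ * x₁
  T₁⇒ {x₀} {x₁} Tr≈1 = begin
    2# * x₀                          ≈⟨ solve 3 (λ a₁ x₀ x₁ → #2 :* x₀ := x₀ :+ (x₀ :- a₁ :* x₁) :+ a₁ :* x₁)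
                                           refl a₁ x₀ x₁ ⟩
    x₀ + (x₀ - a₁ * x₁) + a₁ * x₁    ≈⟨ +-congʳ Tr≈1 ⟩
    1# + a₁ * x₁                     ∎

  T₁⇐ : ∀ {x₀ x₁} → 2# * x₀ ≈ 1# + a₁ * x₁ → T₁ (x₀ , x₁)
  T₁⇐ {x₀} {x₁} 2x₀≈1+a₁x₁ = begin
    x₀ + (x₀ - a₁ * x₁)              ≈⟨ solve 3 (λ a₁ x₀ x₁ → x₀ :+ (x₀ :- a₁ :* x₁) := #2 :* x₀ :- a₁ :* x₁)
                                           refl a₁ x₀ x₁ ⟩
    2# * x₀ - a₁ * x₁                ≈⟨ +-congʳ 2x₀≈1+a₁x₁ ⟩
    1# + a₁ * x₁ - a₁ * x₁           ≈⟨ solve 2 (λ a₁ x₁ → #1 :+ a₁ :* x₁ :- a₁ :* x₁ := #1)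
                                           refl a₁ x₁ ⟩
    1#                               ∎

  traceOne : Carrier → L
  traceOne t = (½ * (1# + a₁ * t) , t)

  T₁-traceOne : ∀ t → T₁ (traceOne t)
  T₁-traceOne t = T₁⇐ (trans (sym (*-assoc 2# ½ _)) ([2*½]*x≈x _))

  T₁-*L : ∀ {x₀ x₁ y₀ y₁} → T₁ (x₀ , x₁) → T₁ (y₀ , y₁) →
          4# * proj₁ ((x₀ , x₁) *L (y₀ , y₁)) ≈ 1# + a₁ * (x₁ + y₁) + Δ * (x₁ * y₁) ×
          2# * proj₂ ((x₀ , x₁) *L (y₀ , y₁)) ≈ x₁ + y₁
  T₁-*L {x₀} {x₁} {y₀} {y₁} Tx Ty = first , second
    where
    u≈ : 2# * x₀ ≈ 1# + a₁ * x₁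
    u≈ = T₁⇒ Tx
    v≈ : 2# * y₀ ≈ 1# + a₁ * y₁
    v≈ = T₁⇒ Ty

    first : 4# * (x₀ * y₀ - a₂ * (x₁ * y₁)) ≈ 1# + a₁ * (x₁ + y₁) + Δ * (x₁ * y₁)
    first = begin
      4# * (x₀ * y₀ - a₂ * (x₁ * y₁))
        ≈⟨ solve 5 (λ a₂ x₀ x₁ y₀ y₁ → #4 :* (x₀ :* y₀ :- a₂ :* (x₁ :* y₁))
                    := (#2 :* x₀) :* (#2 :* y₀) :- #4 :* a₂ :* (x₁ :* y₁)) refl a₂ x₀ x₁ y₀ y₁ ⟩
      (2# * x₀) * (2# * y₀) - 4# * a₂ * (x₁ * y₁)
        ≈⟨ +-congʳ (*-cong u≈ v≈) ⟩
      (1# + a₁ * x₁) * (1# + a₁ * y₁) - 4# * a₂ * (x₁ * y₁)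
        ≈⟨ solve 4 (λ a₁ a₂ x₁ y₁ → (#1 :+ a₁ :* x₁) :* (#1 :+ a₁ :* y₁) :- #4 :* a₂ :* (x₁ :* y₁)
                    := #1 :+ a₁ :* (x₁ :+ y₁) :+ Δ-poly a₁ a₂ :* (x₁ :* y₁))
                refl a₁ a₂ x₁ y₁ ⟩
      1# + a₁ * (x₁ + y₁) + Δ * (x₁ * y₁) ∎

    second : 2# * (x₀ * y₁ + x₁ * y₀ - a₁ * (x₁ * y₁)) ≈ x₁ + y₁
    second = begin
      2# * (x₀ * y₁ + x₁ * y₀ - a₁ * (x₁ * y₁))
        ≈⟨ solve 5 (λ a₁ x₀ x₁ y₀ y₁ → #2 :* (x₀ :* y₁ :+ x₁ :* y₀ :- a₁ :* (x₁ :* y₁))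
                    := (#2 :* x₀) :* y₁ :+ x₁ :* (#2 :* y₀) :- #2 :* a₁ :* (x₁ :* y₁)) refl a₁ x₀ x₁ y₀ y₁ ⟩
      (2# * x₀) * y₁ + x₁ * (2# * y₀) - 2# * a₁ * (x₁ * y₁)
        ≈⟨ +-congʳ (+-cong (*-congʳ u≈) (*-congˡ v≈)) ⟩
      (1# + a₁ * x₁) * y₁ + x₁ * (1# + a₁ * y₁) - 2# * a₁ * (x₁ * y₁)
        ≈⟨ solve 3 (λ a₁ x₁ y₁ → (#1 :+ a₁ :* x₁) :* y₁ :+ x₁ :* (#1 :+ a₁ :* y₁)
                                   :- #2 :* a₁ :* (x₁ :* y₁) := x₁ :+ y₁) refl a₁ x₁ y₁ ⟩
      x₁ + y₁ ∎

  4*numerator≈Δ[s-t]² : ∀ {b₀ b₁ s t} →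
                        4# * b₀ ≈ 1# + a₁ * (s + t) + Δ * (s * t) → 2# * b₁ ≈ s + t →
                        4# * numerator b₀ b₁ ≈ Δ * ((s - t) * (s - t))
  4*numerator≈Δ[s-t]² {b₀} {b₁} {s} {t} 4b₀≈ 2b₁≈ = begin
    4# * numerator b₀ b₁
      ≈⟨ solve 4 (λ a₁ a₂ b₀ b₁ →
                   #4 :* numerator-poly a₁ a₂ b₀ b₁
                   := 4*numerator-poly a₁ a₂ (#4 :* b₀) (#2 :* b₁))
                 refl a₁ a₂ b₀ b₁ ⟩
    (a₁ * (2# * b₁) + 2#) * (a₁ * (2# * b₁) + 2#) - 4# * (4# * b₀) - 4# * a₂ * ((2# * b₁) * (2# * b₁))
      ≈⟨ +-cong (+-cong (*-cong (+-congʳ (*-congˡ 2b₁≈)) (+-congʳ (*-congˡ 2b₁≈))) (-‿cong (*-congˡ 4b₀≈)))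
                (-‿cong (*-congˡ (*-cong 2b₁≈ 2b₁≈))) ⟩
    (a₁ * (s + t) + 2#) * (a₁ * (s + t) + 2#) - 4# * (1# + a₁ * (s + t) + Δ * (s * t))
      - 4# * a₂ * ((s + t) * (s + t))
      ≈⟨ solve 4 (λ a₁ a₂ s t →
                   4*numerator-poly a₁ a₂ (#1 :+ a₁ :* (s :+ t) :+ Δ-poly a₁ a₂ :* (s :* t)) (s :+ t)
                   := Δ-poly a₁ a₂ :* ((s :- t) :* (s :- t)))
                 refl a₁ a₂ s t ⟩
    Δ * ((s - t) * (s - t)) ∎
    where
    4*numerator-poly : ∀ {n} → Polynomial n → Polynomial n → Polynomial n → Polynomial n → Polynomial n
    4*numerator-poly a₁ a₂ q p = (a₁ :* p :+ #2) :* (a₁ :* p :+ #2) :- #4 :* q :- #4 :* a₂ :* (p :* p)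

  T₁T₁⇔ : ∀ {b₀ b₁} → T₁T₁ (b₀ , b₁) ⇔ ∃ λ w → Δ * (w * w) ≈ numerator b₀ b₁
  T₁T₁⇔ {b₀} {b₁} = mk⇔ T₁T₁⇒ ⇒T₁T₁
    where
    T₁T₁⇒ : T₁T₁ (b₀ , b₁) → ∃ λ w → Δ * (w * w) ≈ numerator b₀ b₁
    T₁T₁⇒ ((x₀ , s) , (y₀ , t) , Tx , Ty , p₀≈b₀ , p₁≈b₁) = halve-square
      (4*numerator≈Δ[s-t]² (trans (*-congˡ (sym p₀≈b₀)) (proj₁ (T₁-*L Tx Ty)))
                           (trans (*-congˡ (sym p₁≈b₁)) (proj₂ (T₁-*L Tx Ty))))

    ⇒T₁T₁ : (∃ λ w → Δ * (w * w) ≈ numerator b₀ b₁) → T₁T₁ (b₀ , b₁)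
    ⇒T₁T₁ (w , Δww≈numerator) =
      traceOne s , traceOne t , T₁-traceOne s , T₁-traceOne t ,
      *-cancelˡ 4≉0 (trans (proj₁ product) 4[xy]₀≈4b₀) ,
      *-cancelˡ char≠2 (trans (proj₂ product) s+t≈2b₁)
      where
      s t : Carrier
      s = b₁ + w
      t = b₁ - w

      product : 4# * proj₁ (traceOne s *L traceOne t) ≈ 1# + a₁ * (s + t) + Δ * (s * t) ×
                2# * proj₂ (traceOne s *L traceOne t) ≈ s + t
      product = T₁-*L (T₁-traceOne s) (T₁-traceOne t)

      s+t≈2b₁ : s + t ≈ 2# * b₁
      s+t≈2b₁ = solve 2 (λ b₁ w → (b₁ :+ w) :+ (b₁ :- w) := #2 :* b₁) refl b₁ w

      4[xy]₀≈4b₀ : 1# + a₁ * (s + t) + Δ * (s * t) ≈ 4# * b₀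
      4[xy]₀≈4b₀ = begin
        1# + a₁ * (s + t) + Δ * (s * t)
          ≈⟨ solve 4 (λ a₁ a₂ b₁ w →
                       #1 :+ a₁ :* ((b₁ :+ w) :+ (b₁ :- w)) :+ Δ-poly a₁ a₂ :* ((b₁ :+ w) :* (b₁ :- w))
                       := #1 :+ #2 :* a₁ :* b₁ :+ Δ-poly a₁ a₂ :* (b₁ :* b₁) :- Δ-poly a₁ a₂ :* (w :* w))
                     refl a₁ a₂ b₁ w ⟩
        1# + 2# * a₁ * b₁ + Δ * (b₁ * b₁) - Δ * (w * w)
          ≈⟨ +-congˡ (-‿cong Δww≈numerator) ⟩
        1# + 2# * a₁ * b₁ + Δ * (b₁ * b₁) - numerator b₀ b₁
          ≈⟨ solve 4 (λ a₁ a₂ b₀ b₁ →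
                       #1 :+ #2 :* a₁ :* b₁ :+ Δ-poly a₁ a₂ :* (b₁ :* b₁)
                       :- numerator-poly a₁ a₂ b₀ b₁
                       := #4 :* b₀)
                     refl a₁ a₂ b₀ b₁ ⟩
        4# * b₀ ∎

proposition2p4 : ∀ {c ℓ : Level} (K : Field c ℓ) →
    let open Field K in
    let open FieldTheory K in
    CharNot2 →
    (a₁ a₂ : Carrier) → IrreducibleMonicQuadratic a₁ a₂ →
    let open Extension a₁ a₂ in
    (b₀ b₁ : Carrier) →
    T₁T₁ (b₀ , b₁) ⇔
      IsSquare (((a₁ * b₁ + 1#) * (a₁ * b₁ + 1#) - 4# * (b₀ + a₂ * (b₁ * b₁)))
                / (a₁ * a₁ - 4# * a₂))
proposition2p4 K char≠2 a₁ a₂ irreducible b₀ b₁ =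
  ⇔-sym (IsSquare-/⇔ (Δ≉0 irreducible)) ⇔-∘ T₁T₁⇔
  where
  open FieldProperties K
  open QuadraticExtension K char≠2 a₁ a₂
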